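{- Let $$T_0=\begin{pmatrix}1&0&1&0\\1&1&1&1\\-1&0&0&-1\\0&0&0&1\end{pmatrix},\quad T_1=\begin{pmatrix}1&0&1&0\\0&1&0&1\\-1&0&0&0\\0&-1&0&0\end{pmatrix},\quad T_\infty=\begin{pmatrix}-1&0&-1&-1\\0&0&0&-1\\1&0&0&0\\-1&1&0&0\end{pmatrix},$$ and $$K=\begin{pmatrix}1&0&0&0\\1&-1&0&0\\0&0&1&1\\0&0&0&-1\end{pmatrix},\qquad L=\begin{pmatrix}0&0&-1&0\\0&0&0&-1\\1&0&1&0\\0&1&0&0\end{pmatrix}.$$ Then $T_0T_1T_\infty=I_4$, $T_1=(KL^{ -2})^3L^{ -1}$, $T_\infty=(KL^{ -5})^4$, and the group $\Gamma=\langle T_0,T_1,T_\infty\rangle$ is the commutator subgroup of $G=\langle K,L\rangle$, which has index $2$ in $G$.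
   Context: By a result of Bender, $G=\langle K,L\rangle$ is a copy of the integral symplectic group $\operatorname{Sp}_4(\mathbb{Z})$. The matrices $T_0,T_1,T_\infty$ are diagonalizable with eigenvalues $e^{2\pi i\theta}$ for exponents $\theta\in\{0,0,1/6,5/6\}$, $\{1/6,1/6,5/6,5/6\}$ and $\{1/5,2/5,3/5,4/5\}$ respectively. -}

module Defs where

open import Data.Nat using (ℕ; zero; suc)
open import Data.Integer using (ℤ; +_; -[1+_]; _+_; _*_)
open import Data.Fin using (Fin)
open import Data.Vec using (Vec; []; _∷_; lookup; tabulate; foldr)
open import Data.Product using (Σ; ∃; _×_; _,_)
open import Data.Sum using (_⊎_)
open import Relation.Binary.PropositionalEquality using (_≡_)
open import Relation.Nullary using (¬_)

-- 4x4 integer matrices, as vectors of rows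
Mat : Set
Mat = Vec (Vec ℤ 4) 4

sumV : ∀ {n} → Vec ℤ n → ℤ
sumV = foldr _ _+_ (+ 0)

_⊗_ : Mat → Mat → Mat
A ⊗ B = tabulate λ i → tabulate λ j →
  sumV (tabulate λ (k : Fin 4) → lookup (lookup A i) k * lookup (lookup B k) j)
infixl 7 _⊗_

-1ℤ : ℤ
-1ℤ = -[1+ 0 ]

I₄ : Mat
I₄ = (+ 1 ∷ + 0 ∷ + 0 ∷ + 0 ∷ [])
   ∷ (+ 0 ∷ + 1 ∷ + 0 ∷ + 0 ∷ [])
   ∷ (+ 0 ∷ + 0 ∷ + 1 ∷ + 0 ∷ [])
   ∷ (+ 0 ∷ + 0 ∷ + 0 ∷ + 1 ∷ []) ∷ []

_^ᴹ_ : Mat → ℕ → Mat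
M ^ᴹ zero = I₄
M ^ᴹ suc n = M ⊗ (M ^ᴹ n)

T₀ : Mat
T₀ = (+ 1 ∷ + 0 ∷ + 1 ∷ + 0 ∷ [])
   ∷ (+ 1 ∷ + 1 ∷ + 1 ∷ + 1 ∷ [])
   ∷ (-1ℤ ∷ + 0 ∷ + 0 ∷ -1ℤ ∷ [])
   ∷ (+ 0 ∷ + 0 ∷ + 0 ∷ + 1 ∷ []) ∷ []

T₁ : Mat
T₁ = (+ 1 ∷ + 0 ∷ + 1 ∷ + 0 ∷ [])
   ∷ (+ 0 ∷ + 1 ∷ + 0 ∷ + 1 ∷ [])
   ∷ (-1ℤ ∷ + 0 ∷ + 0 ∷ + 0 ∷ [])
   ∷ (+ 0 ∷ -1ℤ ∷ + 0 ∷ + 0 ∷ []) ∷ []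

T∞ : Mat
T∞ = (-1ℤ ∷ + 0 ∷ -1ℤ ∷ -1ℤ ∷ [])
   ∷ (+ 0 ∷ + 0 ∷ + 0 ∷ -1ℤ ∷ [])
   ∷ (+ 1 ∷ + 0 ∷ + 0 ∷ + 0 ∷ [])
   ∷ (-1ℤ ∷ + 1 ∷ + 0 ∷ + 0 ∷ []) ∷ []

K : Mat
K = (+ 1 ∷ + 0 ∷ + 0 ∷ + 0 ∷ [])
  ∷ (+ 1 ∷ -1ℤ ∷ + 0 ∷ + 0 ∷ [])
  ∷ (+ 0 ∷ + 0 ∷ + 1 ∷ + 1 ∷ [])
  ∷ (+ 0 ∷ + 0 ∷ + 0 ∷ -1ℤ ∷ []) ∷ []

L : Mat
L = (+ 0 ∷ + 0 ∷ -1ℤ ∷ + 0 ∷ [])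
  ∷ (+ 0 ∷ + 0 ∷ + 0 ∷ -1ℤ ∷ [])
  ∷ (+ 1 ∷ + 0 ∷ + 1 ∷ + 0 ∷ [])
  ∷ (+ 0 ∷ + 1 ∷ + 0 ∷ + 0 ∷ []) ∷ []

-- the inverse of L (that it is a two-sided inverse is part of the theorem)
L⁻¹ : Mat
L⁻¹ = (+ 1 ∷ + 0 ∷ + 1 ∷ + 0 ∷ [])
    ∷ (+ 0 ∷ + 0 ∷ + 0 ∷ + 1 ∷ [])
    ∷ (-1ℤ ∷ + 0 ∷ + 0 ∷ + 0 ∷ [])
    ∷ (+ 0 ∷ -1ℤ ∷ + 0 ∷ + 0 ∷ []) ∷ []

data Gen (S : Mat → Set) : Mat → Set where
  gen : ∀ {M} → S M → Gen S M
  one : Gen S I₄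
  mul : ∀ {M N} → Gen S M → Gen S N → Gen S (M ⊗ N)
  inv : ∀ {M N} → Gen S M → M ⊗ N ≡ I₄ → Gen S N

IsCommutator : (Mat → Set) → Mat → Set
IsCommutator H M =
  Σ Mat λ g → Σ Mat λ h → Σ Mat λ g' → Σ Mat λ h' →
    H g × H h × g ⊗ g' ≡ I₄ × h ⊗ h' ≡ I₄ × M ≡ g ⊗ h ⊗ g' ⊗ h'

Commutator : (Mat → Set) → Mat → Set
Commutator H = Gen (IsCommutator H)

G : Mat → Set
G = Gen (λ M → M ≡ K ⊎ M ≡ L)

Γ : Mat → Set
Γ = Gen (λ M → M ≡ T₀ ⊎ M ≡ T₁ ⊎ M ≡ T∞)

HasIndex2 : (Mat → Set) → (Mat → Set) → Set
HasIndex2 H Gr =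
  (∀ M → H M → Gr M) ×
  Σ Mat λ x → Gr x × ¬ H x ×
    (∀ g → Gr g → H g ⊎ Σ Mat λ y → H y × g ≡ x ⊗ y)

-- X = K L⁻¹ and Y = K L generate the subgroup G⁺ of words of even length in K and L^{±1}, and
-- explicit words show Γ = G⁺. Conjugation by the involution K sends X to Y⁻¹ and Y to X⁻¹, so G⁺
-- is normal and G = G⁺ ∪ K G⁺; the quotient G/G⁺ has order at most 2, hence [G,G] ⊆ G⁺.
-- Conversely X and Y are products of two commutators of G, so G⁺ = [G,G]. Finally K ∉ G⁺:
-- reduced mod 2, G⁺ lies in the orbit of the identity under X and Y, a set of 360 matrices
-- (the image Sp₄(𝔽₂)′ ≅ A₆) that is closed under X^{±1}, Y^{±1} and does not contain K.
module Submission where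

open import Defs
open import Algebra.Bundles using (Semiring; Monoid)
open import Algebra.Morphism.Structures using (IsNearSemiringHomomorphism)
import Algebra.Properties.Semiring.Sum
open import Data.Bool using (Bool; true; false; if_then_else_)
open import Data.Bool.ListAction using (all)
open import Data.Bool.Properties using (T-≡)
open import Data.Fin using (Fin; zero; suc)
open import Data.Integer as ℤ using (ℤ; +_; -[1+_]; ∣_∣; _⊖_)
import Data.Integer.Properties as ℤ
open import Data.List using (List; []; _∷_; _++_; foldr) renaming (map to mapᴸ)
open import Data.List.Membership.Propositional using (_∈_)
open import Data.List.Membership.Propositional.Properties using (∈-map⁺; ∈-++⁺ˡ; ∈-++⁺ʳ)
open import Data.List.Relation.Unary.All as All using (All; []; _∷_)
open import Data.List.Relation.Unary.All.Properties using (all⁺)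
open import Data.List.Relation.Unary.Any using (here)
open import Data.Nat as ℕ using (ℕ; zero; suc; parity)
import Data.Nat.Properties as ℕ
open import Data.Parity.Base as ℙ using (Parity; 0ℙ; 1ℙ)
import Data.Parity.Properties as ℙ
open import Data.Product using (Σ; ∃; ∃-syntax; _×_; _,_; proj₁; proj₂)
open import Data.Sum using (_⊎_; inj₁; inj₂)
open import Data.Vec using (Vec; []; _∷_; lookup; tabulate; map; concat)
open import Data.Vec.Functional using (Vector)
open import Data.Vec.Properties using (lookup∘tabulate; lookup-map)
open import Data.Vec.Relation.Binary.Pointwise.Extensional using (ext; Pointwise-≡⇒≡)
open import Function using (_∘_)
open import Function.Bundles using (Equivalence)
open import Level using (0ℓ)
open import Relation.Binary.PropositionalEquality using (_≡_; refl)
import Relation.Binary.PropositionalEquality as ≡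
open import Relation.Nullary using (¬_)
open import Relation.Unary using (Pred; _⊆_)

-- Square matrices over a semiring

module SquareMatrices {c ℓ} (R : Semiring c ℓ) where
  open Semiring R hiding (zero)
  open import Algebra.Properties.Semiring.Sum R
  open import Relation.Binary.Reasoning.Setoid setoid

  Matrix : ℕ → Set c
  Matrix n = Vec (Vec Carrier n) n

  infix 10 _[_,_]
  _[_,_] : ∀ {n} → Matrix n → Fin n → Fin n → Carrier
  A [ i , j ] = lookup (lookup A i) j

  fromEntries : ∀ {n} → (Fin n → Fin n → Carrier) → Matrix n
  fromEntries f = tabulate λ i → tabulate (f i)

  fromEntries-[,] : ∀ {n} (f : Fin n → Fin n → Carrier) i j → fromEntries f [ i , j ] ≡ f i j
  fromEntries-[,] f i j = ≡.trans (≡.cong (λ row → lookup row j) (lookup∘tabulate _ i)) (lookup∘tabulate (f i) j)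

  Matrix-ext : ∀ {n} {A B : Matrix n} → (∀ i j → A [ i , j ] ≡ B [ i , j ]) → A ≡ B
  Matrix-ext A≐B = Pointwise-≡⇒≡ (ext λ i → Pointwise-≡⇒≡ (ext (A≐B i)))

  infixl 7 _·_
  _·_ : ∀ {n} → Matrix n → Matrix n → Matrix n
  _·_ {n} A B = fromEntries λ i j → ∑[ k < n ] (A [ i , k ] * B [ k , j ])

  δ : ∀ {n} → Fin n → Fin n → Carrier
  δ zero    zero    = 1#
  δ zero    (suc _) = 0#
  δ (suc _) zero    = 0#
  δ (suc i) (suc j) = δ i j

  1ᴹ : ∀ {n} → Matrix n
  1ᴹ = fromEntries δ

  ∑-δˡ : ∀ {n} (i : Fin n) (f : Vector Carrier n) → ∑[ k < n ] (δ i k * f k) ≈ f i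
  ∑-δˡ {suc n} zero f = begin
    1# * f zero + ∑[ k < n ] (0# * f (suc k))
      ≈⟨ +-cong (*-identityˡ _) (trans (sum-cong-≋ {n} (λ k → zeroˡ (f (suc k)))) (sum-replicate-zero n)) ⟩
    f zero + 0#                              ≈⟨ +-identityʳ _ ⟩
    f zero                                   ∎
  ∑-δˡ {suc n} (suc i) f = begin
    0# * f zero + ∑[ k < n ] (δ i k * f (suc k)) ≈⟨ +-cong (zeroˡ _) (∑-δˡ i (f ∘ suc)) ⟩
    0# + f (suc i)                              ≈⟨ +-identityˡ _ ⟩
    f (suc i)                                   ∎

  ∑-δʳ : ∀ {n} (j : Fin n) (f : Vector Carrier n) → ∑[ k < n ] (f k * δ k j) ≈ f j
  ∑-δʳ {suc n} zero f = begin
    f zero * 1# + ∑[ k < n ] (f (suc k) * 0#)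
      ≈⟨ +-cong (*-identityʳ _) (trans (sum-cong-≋ {n} (λ k → zeroʳ (f (suc k)))) (sum-replicate-zero n)) ⟩
    f zero + 0#                              ≈⟨ +-identityʳ _ ⟩
    f zero                                   ∎
  ∑-δʳ {suc n} (suc j) f = begin
    f zero * 0# + ∑[ k < n ] (f (suc k) * δ k j) ≈⟨ +-cong (zeroʳ _) (∑-δʳ j (f ∘ suc)) ⟩
    0# + f (suc j)                              ≈⟨ +-identityˡ _ ⟩
    f (suc j)                                   ∎

  ·-[,] : ∀ {n} (A B : Matrix n) i j → (A · B) [ i , j ] ≡ ∑[ k < n ] (A [ i , k ] * B [ k , j ])
  ·-[,] A B = fromEntries-[,] _

  ·-assoc : ∀ {n} (A B C : Matrix n) i j → ((A · B) · C) [ i , j ] ≈ (A · (B · C)) [ i , j ]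
  ·-assoc {n} A B C i j = begin
    ((A · B) · C) [ i , j ]
      ≡⟨ ·-[,] (A · B) C i j ⟩
    ∑[ k < n ] ((A · B) [ i , k ] * C [ k , j ])
      ≡⟨ sum-cong-≗ (λ k → ≡.cong (_* C [ k , j ]) (·-[,] A B i k)) ⟩
    ∑[ k < n ] (∑[ l < n ] (A [ i , l ] * B [ l , k ]) * C [ k , j ])
      ≈⟨ sum-cong-≋ {n} (λ k → *-distribʳ-sum (C [ k , j ]) (λ l → A [ i , l ] * B [ l , k ])) ⟩
    ∑[ k < n ] ∑[ l < n ] (A [ i , l ] * B [ l , k ] * C [ k , j ])
      ≈⟨ ∑-comm (λ k l → A [ i , l ] * B [ l , k ] * C [ k , j ]) ⟩
    ∑[ l < n ] ∑[ k < n ] (A [ i , l ] * B [ l , k ] * C [ k , j ])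
      ≈⟨ sum-cong-≋ {n} (λ l → sum-cong-≋ {n} (λ k → *-assoc (A [ i , l ]) (B [ l , k ]) (C [ k , j ]))) ⟩
    ∑[ l < n ] ∑[ k < n ] (A [ i , l ] * (B [ l , k ] * C [ k , j ]))
      ≈⟨ sum-cong-≋ {n} (λ l → sym (*-distribˡ-sum (A [ i , l ]) (λ k → B [ l , k ] * C [ k , j ]))) ⟩
    ∑[ l < n ] (A [ i , l ] * ∑[ k < n ] (B [ l , k ] * C [ k , j ]))
      ≡⟨ sum-cong-≗ (λ l → ≡.cong (A [ i , l ] *_) (≡.sym (·-[,] B C l j))) ⟩
    ∑[ l < n ] (A [ i , l ] * (B · C) [ l , j ])
      ≡⟨ ≡.sym (·-[,] A (B · C) i j) ⟩
    (A · (B · C)) [ i , j ]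
      ∎

  ·-identityˡ : ∀ {n} (A : Matrix n) i j → (1ᴹ · A) [ i , j ] ≈ A [ i , j ]
  ·-identityˡ {n} A i j = begin
    (1ᴹ · A) [ i , j ]                       ≡⟨ ·-[,] 1ᴹ A i j ⟩
    ∑[ k < n ] (1ᴹ [ i , k ] * A [ k , j ])  ≡⟨ sum-cong-≗ (λ k → ≡.cong (_* A [ k , j ]) (fromEntries-[,] δ i k)) ⟩
    ∑[ k < n ] (δ i k * A [ k , j ])         ≈⟨ ∑-δˡ i (λ k → A [ k , j ]) ⟩
    A [ i , j ]                              ∎

  ·-identityʳ : ∀ {n} (A : Matrix n) i j → (A · 1ᴹ) [ i , j ] ≈ A [ i , j ]
  ·-identityʳ {n} A i j = begin
    (A · 1ᴹ) [ i , j ]                       ≡⟨ ·-[,] A 1ᴹ i j ⟩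
    ∑[ k < n ] (A [ i , k ] * 1ᴹ [ k , j ])  ≡⟨ sum-cong-≗ (λ k → ≡.cong (A [ i , k ] *_) (fromEntries-[,] δ k j)) ⟩
    ∑[ k < n ] (A [ i , k ] * δ k j)         ≈⟨ ∑-δʳ j (λ k → A [ i , k ]) ⟩
    A [ i , j ]                              ∎

module SquareMatrixHomomorphism
  {c₁ ℓ₁ c₂ ℓ₂} (R : Semiring c₁ ℓ₁) (S : Semiring c₂ ℓ₂)
  {f : Semiring.Carrier R → Semiring.Carrier S}
  (f-homo : IsNearSemiringHomomorphism (Semiring.rawNearSemiring R) (Semiring.rawNearSemiring S) f)
  where
  open Semiring S hiding (zero)
  open Semiring R using () renaming (Carrier to Carrierᴿ; _*_ to _*ᴿ_)
  open IsNearSemiringHomomorphism f-homo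
  open SquareMatrices R using (Matrix) renaming (_[_,_] to _[_,_]ᴿ; _·_ to _·ᴿ_; ·-[,] to ·ᴿ-[,])
  open SquareMatrices S using (_[_,_]; _·_; ·-[,])
  module ∑ᴿ = Algebra.Properties.Semiring.Sum R
  open import Algebra.Properties.Semiring.Sum S
  open import Relation.Binary.Reasoning.Setoid setoid

  mapᴹ : ∀ {n} → Matrix n → SquareMatrices.Matrix S n
  mapᴹ = map (map f)

  mapᴹ-[,] : ∀ {n} (A : Matrix n) i j → mapᴹ A [ i , j ] ≡ f (A [ i , j ]ᴿ)
  mapᴹ-[,] A i j = ≡.trans (≡.cong (λ row → lookup row j) (lookup-map i (map f) A)) (lookup-map j f (lookup A i))

  f-∑ : ∀ n (g : Vector Carrierᴿ n) → f (∑ᴿ.∑[ k < n ] g k) ≈ ∑[ k < n ] f (g k)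
  f-∑ zero    g = 0#-homo
  f-∑ (suc n) g = trans (+-homo (g zero) _) (+-congˡ (f-∑ n (g ∘ suc)))

  mapᴹ-· : ∀ {n} (A B : Matrix n) i j → mapᴹ (A ·ᴿ B) [ i , j ] ≈ (mapᴹ A · mapᴹ B) [ i , j ]
  mapᴹ-· {n} A B i j = begin
    mapᴹ (A ·ᴿ B) [ i , j ]                            ≡⟨ mapᴹ-[,] (A ·ᴿ B) i j ⟩
    f ((A ·ᴿ B) [ i , j ]ᴿ)                            ≡⟨ ≡.cong f (·ᴿ-[,] A B i j) ⟩
    f (∑ᴿ.∑[ k < n ] (A [ i , k ]ᴿ *ᴿ B [ k , j ]ᴿ))    ≈⟨ f-∑ n _ ⟩
    ∑[ k < n ] f (A [ i , k ]ᴿ *ᴿ B [ k , j ]ᴿ)         ≈⟨ sum-cong-≋ {n} (λ k → *-homo (A [ i , k ]ᴿ) (B [ k , j ]ᴿ)) ⟩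
    ∑[ k < n ] (f (A [ i , k ]ᴿ) * f (B [ k , j ]ᴿ))   ≡⟨ sum-cong-≗ (λ k → ≡.sym (≡.cong₂ _*_ (mapᴹ-[,] A i k) (mapᴹ-[,] B k j))) ⟩
    ∑[ k < n ] (mapᴹ A [ i , k ] * mapᴹ B [ k , j ])   ≡⟨ ≡.sym (·-[,] (mapᴹ A) (mapᴹ B) i j) ⟩
    (mapᴹ A · mapᴹ B) [ i , j ]                        ∎

-- Integer matrices and their reduction mod 2

-- The product _⊗_ and identity I₄ of Defs are definitionally those of SquareMatrices over ℤ.
open SquareMatrices ℤ.+-*-semiring using (Matrix-ext; ·-assoc; ·-identityˡ; ·-identityʳ)

⊗-assoc : ∀ A B C → A ⊗ B ⊗ C ≡ A ⊗ (B ⊗ C)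
⊗-assoc A B C = Matrix-ext (·-assoc A B C)

⊗-identityˡ : ∀ A → I₄ ⊗ A ≡ A
⊗-identityˡ A = Matrix-ext (·-identityˡ A)

⊗-identityʳ : ∀ A → A ⊗ I₄ ≡ A
⊗-identityʳ A = Matrix-ext (·-identityʳ A)

Mat-monoid : Monoid 0ℓ 0ℓ
Mat-monoid = record
  { Carrier = Mat ; _≈_ = _≡_ ; _∙_ = _⊗_ ; ε = I₄
  ; isMonoid = record
    { isSemigroup = record
      { isMagma = record { isEquivalence = ≡.isEquivalence ; ∙-cong = ≡.cong₂ _⊗_ }
      ; assoc = ⊗-assoc }
    ; identity = ⊗-identityˡ , ⊗-identityʳ } }

open import Algebra.Properties.Monoid Mat-monoid using (cancelˡ; cancelʳ; cancelᶜ)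

inverse-unique : ∀ M M′ N → M′ ⊗ M ≡ I₄ → M ⊗ N ≡ I₄ → N ≡ M′
inverse-unique M M′ N M′M≡I MN≡I = begin
  N               ≡⟨ ≡.sym (cancelˡ {a = M′} {c = M} M′M≡I N) ⟩
  M′ ⊗ (M ⊗ N)    ≡⟨ ≡.cong (M′ ⊗_) MN≡I ⟩
  M′ ⊗ I₄         ≡⟨ ⊗-identityʳ M′ ⟩
  M′              ∎
  where open ≡.≡-Reasoning

⊗-inverse : ∀ M M′ N N′ → M ⊗ M′ ≡ I₄ → N ⊗ N′ ≡ I₄ → M ⊗ N ⊗ (N′ ⊗ M′) ≡ I₄
⊗-inverse M M′ N N′ MM′≡I NN′≡I = ≡.trans (cancelᶜ {a = N} {c = N′} NN′≡I M M′) MM′≡I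

parityℤ : ℤ → Parity
parityℤ i = parity ∣ i ∣

parity-suc-+-suc : ∀ m n → parity (suc m) ℙ.+ parity (suc n) ≡ parity m ℙ.+ parity n
parity-suc-+-suc m n = begin
  parity (suc m) ℙ.+ parity (suc n) ≡⟨ ≡.sym (ℙ.+-homo-+ (suc m) (suc n)) ⟩
  parity (suc m ℕ.+ suc n)          ≡⟨ ≡.cong (parity ∘ suc) (ℕ.+-suc m n) ⟩
  parity (m ℕ.+ n)                  ≡⟨ ℙ.+-homo-+ m n ⟩
  parity m ℙ.+ parity n             ∎
  where open ≡.≡-Reasoning

parityℤ-⊖ : ∀ m n → parityℤ (m ⊖ n) ≡ parity m ℙ.+ parity n
parityℤ-⊖ zero    zero    = refl
parityℤ-⊖ zero    (suc n) = refl
parityℤ-⊖ (suc m) zero    = ≡.sym (ℙ.+-identityʳ _)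
parityℤ-⊖ (suc m) (suc n) = begin
  parityℤ (suc m ⊖ suc n)           ≡⟨ ≡.cong parityℤ (ℤ.[1+m]⊖[1+n]≡m⊖n m n) ⟩
  parityℤ (m ⊖ n)                   ≡⟨ parityℤ-⊖ m n ⟩
  parity m ℙ.+ parity n             ≡⟨ ≡.sym (parity-suc-+-suc m n) ⟩
  parity (suc m) ℙ.+ parity (suc n) ∎
  where open ≡.≡-Reasoning

parityℤ-+ : ∀ i j → parityℤ (i ℤ.+ j) ≡ parityℤ i ℙ.+ parityℤ j
parityℤ-+ (+ m)    (+ n)    = ℙ.+-homo-+ m n
parityℤ-+ (+ m)    -[1+ n ] = parityℤ-⊖ m (suc n)
parityℤ-+ -[1+ m ] (+ n)    = ≡.trans (parityℤ-⊖ n (suc m)) (ℙ.+-comm (parity n) _)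
parityℤ-+ -[1+ m ] -[1+ n ] = ≡.trans (ℙ.+-homo-+ m n) (≡.sym (parity-suc-+-suc m n))

parityℤ-* : ∀ i j → parityℤ (i ℤ.* j) ≡ parityℤ i ℙ.* parityℤ j
parityℤ-* i j = ≡.trans (≡.cong parity (ℤ.abs-* i j)) (ℙ.*-homo-* ∣ i ∣ ∣ j ∣)

parityℤ-isNearSemiringHomomorphism :
  IsNearSemiringHomomorphism (Semiring.rawNearSemiring ℤ.+-*-semiring) (Semiring.rawNearSemiring ℙ.+-*-semiring)
                             parityℤ
parityℤ-isNearSemiringHomomorphism = record
  { +-isMonoidHomomorphism = record
    { isMagmaHomomorphism = record
      { isRelHomomorphism = record { cong = ≡.cong parityℤ }
      ; homo = parityℤ-+
      }
    ; ε-homo = refl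
    }
  ; *-homo = parityℤ-*
  }

Mat₂ : Set
Mat₂ = SquareMatrices.Matrix ℙ.+-*-semiring 4

open SquareMatrices ℙ.+-*-semiring using () renaming (_·_ to _⊙_; Matrix-ext to Mat₂-ext)
open SquareMatrixHomomorphism ℤ.+-*-semiring ℙ.+-*-semiring parityℤ-isNearSemiringHomomorphism
  using () renaming (mapᴹ to reduce; mapᴹ-· to reduce-·)

reduce-⊗ : ∀ A B → reduce (A ⊗ B) ≡ reduce A ⊙ reduce B
reduce-⊗ A B = Mat₂-ext (reduce-· A B)

-- Subgroups of GL₄(ℤ)

record IsSubgroup {ℓ} (P : Pred Mat ℓ) : Set ℓ where
  field
    ∈-I   : P I₄
    ∈-⊗   : ∀ {M N} → P M → P N → P (M ⊗ N)
    ∈-inv : ∀ {M N} → P M → M ⊗ N ≡ I₄ → P N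

Gen-least : ∀ {ℓ S} {P : Pred Mat ℓ} → IsSubgroup P → S ⊆ P → Gen S ⊆ P
Gen-least P-sub S⊆P (gen s)   = S⊆P s
Gen-least P-sub S⊆P one       = IsSubgroup.∈-I P-sub
Gen-least P-sub S⊆P (mul p q) = IsSubgroup.∈-⊗ P-sub (Gen-least P-sub S⊆P p) (Gen-least P-sub S⊆P q)
Gen-least P-sub S⊆P (inv p e) = IsSubgroup.∈-inv P-sub (Gen-least P-sub S⊆P p) e

Gen-isSubgroup : ∀ {S} → IsSubgroup (Gen S)
Gen-isSubgroup = record { ∈-I = one ; ∈-⊗ = mul ; ∈-inv = inv }

Gen-mono : ∀ {S T} → S ⊆ Gen T → Gen S ⊆ Gen T
Gen-mono = Gen-least Gen-isSubgroup

preimage-isSubgroup : ∀ {ℓ} {P : Pred Mat ℓ} (φ : Mat → Mat) → φ I₄ ≡ I₄ → (∀ M N → φ (M ⊗ N) ≡ φ M ⊗ φ N) →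
                      IsSubgroup P → IsSubgroup (P ∘ φ)
preimage-isSubgroup {P = P} φ φ-I φ-⊗ P-sub = record
  { ∈-I   = ≡.subst P (≡.sym φ-I) ∈-I
  ; ∈-⊗   = λ {M} {N} p q → ≡.subst P (≡.sym (φ-⊗ M N)) (∈-⊗ p q)
  ; ∈-inv = λ {M} {N} p MN≡I → ∈-inv p (≡.trans (≡.sym (φ-⊗ M N)) (≡.trans (≡.cong φ MN≡I) φ-I))
  }
  where open IsSubgroup P-sub

Invertible-in : ∀ {ℓ} → Pred Mat ℓ → Pred Mat ℓ
Invertible-in P M = P M × ∃[ M′ ] (M ⊗ M′ ≡ I₄ × M′ ⊗ M ≡ I₄ × P M′)

Invertible-in-isSubgroup : ∀ {ℓ} {P : Pred Mat ℓ} → P I₄ → (∀ {M N} → P M → P N → P (M ⊗ N)) →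
                           IsSubgroup (Invertible-in P)
Invertible-in-isSubgroup {P = P} P-I P-⊗ = record
  { ∈-I   = P-I , I₄ , ⊗-identityˡ I₄ , ⊗-identityˡ I₄ , P-I
  ; ∈-⊗   = λ { {M} {N} (PM , M′ , MM′ , M′M , PM′) (PN , N′ , NN′ , N′N , PN′) →
              P-⊗ PM PN , N′ ⊗ M′ , ⊗-inverse M M′ N N′ MM′ NN′ , ⊗-inverse N′ N M′ M N′N M′M , P-⊗ PN′ PM′ }
  ; ∈-inv = λ { {M} {N} (PM , M′ , MM′ , M′M , PM′) MN≡I →
              ≡.subst (Invertible-in P) (≡.sym (inverse-unique M M′ N M′M MN≡I)) (PM′ , M , M′M , MM′ , PM) }
  }

Gen-induction : ∀ {ℓ S} (P : Pred Mat ℓ) → P I₄ → (∀ {M N} → P M → P N → P (M ⊗ N)) →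
                S ⊆ Invertible-in P → Gen S ⊆ P
Gen-induction P P-I P-⊗ S⊆ = proj₁ ∘ Gen-least (Invertible-in-isSubgroup P-I P-⊗) S⊆

∏ : List Mat → Mat
∏ = foldr _⊗_ I₄

Gen-∏ : ∀ {S Ms} → All (Gen S) Ms → Gen S (∏ Ms)
Gen-∏ []       = one
Gen-∏ (p ∷ ps) = mul p (Gen-∏ ps)

Gen-^ : ∀ {S M} n → Gen S M → Gen S (M ^ᴹ n)
Gen-^ zero    p = one
Gen-^ (suc n) p = mul p (Gen-^ n p)

Commutator⊆Gen : ∀ {S} → Commutator (Gen S) ⊆ Gen S
Commutator⊆Gen {S} = Gen-least Gen-isSubgroup commutator∈Gen
  where
  commutator∈Gen : IsCommutator (Gen S) ⊆ Gen S
  commutator∈Gen (g , h , g′ , h′ , Sg , Sh , gg′≡I , hh′≡I , refl) =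
    mul {M = g ⊗ h ⊗ g′} {N = h′}
        (mul {M = g ⊗ h} {N = g′} (mul {M = g} {N = h} Sg Sh) (inv {M = g} {N = g′} Sg gg′≡I))
        (inv {M = h} {N = h′} Sh hh′≡I)

∏-commutator : ∀ {S us vs} (us′ vs′ : List Mat) → All (Gen S) us → All (Gen S) vs →
               ∏ us ⊗ ∏ us′ ≡ I₄ → ∏ vs ⊗ ∏ vs′ ≡ I₄ → Commutator (Gen S) (∏ us ⊗ ∏ vs ⊗ ∏ us′ ⊗ ∏ vs′)
∏-commutator {us = us} {vs} us′ vs′ Sus Svs uu′≡I vv′≡I =
  gen (∏ us , ∏ vs , ∏ us′ , ∏ vs′ , Gen-∏ Sus , Gen-∏ Svs , uu′≡I , vv′≡I , refl)

module InvolutionCosets {S : Pred Mat 0ℓ} (k : Mat) (k²≡I : k ⊗ k ≡ I₄)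
                        (conj-S : S ⊆ λ M → Gen S (k ⊗ M ⊗ k)) where

  conj-I : k ⊗ I₄ ⊗ k ≡ I₄
  conj-I = ≡.trans (≡.cong (_⊗ k) (⊗-identityʳ k)) k²≡I

  sandwich : ∀ M N → k ⊗ M ⊗ (N ⊗ k) ≡ k ⊗ (M ⊗ N) ⊗ k
  sandwich M N = ≡.trans (≡.sym (⊗-assoc (k ⊗ M) N k)) (≡.cong (_⊗ k) (⊗-assoc k M N))

  conj-⊗ : ∀ M N → k ⊗ (M ⊗ N) ⊗ k ≡ k ⊗ M ⊗ k ⊗ (k ⊗ N ⊗ k)
  conj-⊗ M N = begin
    k ⊗ (M ⊗ N) ⊗ k             ≡⟨ ≡.sym (sandwich M N) ⟩
    k ⊗ M ⊗ (N ⊗ k)             ≡⟨ ≡.sym (cancelᶜ {a = k} {c = k} k²≡I (k ⊗ M) (N ⊗ k)) ⟩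
    k ⊗ M ⊗ k ⊗ (k ⊗ (N ⊗ k))   ≡⟨ ≡.cong (k ⊗ M ⊗ k ⊗_) (≡.sym (⊗-assoc k N k)) ⟩
    k ⊗ M ⊗ k ⊗ (k ⊗ N ⊗ k)     ∎
    where open ≡.≡-Reasoning

  conj : Gen S ⊆ λ M → Gen S (k ⊗ M ⊗ k)
  conj = Gen-least (preimage-isSubgroup (λ M → k ⊗ M ⊗ k) conj-I conj-⊗ Gen-isSubgroup) conj-S

  Coset : Parity → Pred Mat 0ℓ
  Coset 0ℙ M = Gen S M
  Coset 1ℙ M = Gen S (k ⊗ M)

  Coset-⊗ : ∀ {p q} M N → Coset p M → Coset q N → Coset (p ℙ.+ q) (M ⊗ N)
  Coset-⊗ {0ℙ} {0ℙ} M N m n = mul m n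
  Coset-⊗ {0ℙ} {1ℙ} M N m n =
    ≡.subst (Gen S) (≡.trans (cancelᶜ {a = k} {c = k} k²≡I (k ⊗ M) N) (⊗-assoc k M N)) (mul (conj {M} m) n)
  Coset-⊗ {1ℙ} {0ℙ} M N m n = ≡.subst (Gen S) (⊗-assoc k M N) (mul m n)
  Coset-⊗ {1ℙ} {1ℙ} M N m n =
    ≡.subst (Gen S) (≡.trans (cancelᶜ {a = k} {c = k} k²≡I (k ⊗ (k ⊗ M)) N)
                             (≡.cong (_⊗ N) (cancelˡ {a = k} {c = k} k²≡I M)))
            (mul (conj {k ⊗ M} m) n)

  Coset-inv : ∀ {p} M N → Coset p M → M ⊗ N ≡ I₄ → Coset p N
  Coset-inv {0ℙ} M N m MN≡I = inv m MN≡I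
  Coset-inv {1ℙ} M N m MN≡I = ≡.subst (Gen S) k[Nk]k≡kN (conj {N ⊗ k} (inv {M = k ⊗ M} m kM[Nk]≡I))
    where
    kM[Nk]≡I : k ⊗ M ⊗ (N ⊗ k) ≡ I₄
    kM[Nk]≡I = ≡.trans (sandwich M N) (≡.trans (≡.cong (λ X → k ⊗ X ⊗ k) MN≡I) conj-I)
    k[Nk]k≡kN : k ⊗ (N ⊗ k) ⊗ k ≡ k ⊗ N
    k[Nk]k≡kN = ≡.trans (≡.cong (_⊗ k) (≡.sym (⊗-assoc k N k))) (cancelʳ {a = k} {c = k} k²≡I (k ⊗ N))

  InSomeCoset : Pred Mat 0ℓ
  InSomeCoset M = ∃ λ p → Coset p M

  InSomeCoset-isSubgroup : IsSubgroup InSomeCoset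
  InSomeCoset-isSubgroup = record
    { ∈-I   = 0ℙ , one
    ; ∈-⊗   = λ { {M} {N} (p , m) (q , n) → p ℙ.+ q , Coset-⊗ M N m n }
    ; ∈-inv = λ { {M} {N} (p , m) MN≡I → p , Coset-inv M N m MN≡I }
    }

  Gen⊆InSomeCoset : ∀ {T} → T ⊆ InSomeCoset → Gen T ⊆ InSomeCoset
  Gen⊆InSomeCoset = Gen-least InSomeCoset-isSubgroup

  Coset-commutator : ∀ {p q} g h g′ h′ → Coset p g → Coset q h → g ⊗ g′ ≡ I₄ → h ⊗ h′ ≡ I₄ →
                     Gen S (g ⊗ h ⊗ g′ ⊗ h′)
  Coset-commutator {p} {q} g h g′ h′ cg ch gg′≡I hh′≡I =
    ≡.subst (λ r → Coset r (g ⊗ h ⊗ g′ ⊗ h′)) (p+q+p+q≡0 p q)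
      (Coset-⊗ (g ⊗ h ⊗ g′) h′ (Coset-⊗ (g ⊗ h) g′ (Coset-⊗ g h cg ch) (Coset-inv g g′ cg gg′≡I))
               (Coset-inv h h′ ch hh′≡I))
    where
    p+q+p+q≡0 : ∀ p q → p ℙ.+ q ℙ.+ p ℙ.+ q ≡ 0ℙ
    p+q+p+q≡0 0ℙ 0ℙ = refl
    p+q+p+q≡0 0ℙ 1ℙ = refl
    p+q+p+q≡0 1ℙ 0ℙ = refl
    p+q+p+q≡0 1ℙ 1ℙ = refl

  Commutator⊆ : ∀ {T} → T ⊆ InSomeCoset → Commutator (Gen T) ⊆ Gen S
  Commutator⊆ {T} T⊆ = Gen-least Gen-isSubgroup commutator∈
    where
    commutator∈ : IsCommutator (Gen T) ⊆ Gen S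
    commutator∈ (g , h , g′ , h′ , Tg , Th , gg′≡I , hh′≡I , refl) =
      Coset-commutator g h g′ h′ (proj₂ (Gen⊆InSomeCoset T⊆ Tg)) (proj₂ (Gen⊆InSomeCoset T⊆ Th)) gg′≡I hh′≡I

-- Finite sets of matrices mod 2

data BitSet : ℕ → Set where
  ∅    : ∀ {n} → BitSet n
  ⟨[]⟩ : BitSet zero
  node : ∀ {n} → BitSet n → BitSet n → BitSet (suc n)

infix 4 _∈ᵇ_
_∈ᵇ_ : ∀ {n} → Vec Parity n → BitSet n → Bool
v        ∈ᵇ ∅            = false
[]       ∈ᵇ ⟨[]⟩         = true
(0ℙ ∷ v) ∈ᵇ node S₀ S₁   = v ∈ᵇ S₀
(1ℙ ∷ v) ∈ᵇ node S₀ S₁   = v ∈ᵇ S₁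

insert : ∀ {n} → Vec Parity n → BitSet n → BitSet n
insert []       _            = ⟨[]⟩
insert (0ℙ ∷ v) ∅            = node (insert v ∅) ∅
insert (1ℙ ∷ v) ∅            = node ∅ (insert v ∅)
insert (0ℙ ∷ v) (node S₀ S₁) = node (insert v S₀) S₁
insert (1ℙ ∷ v) (node S₀ S₁) = node S₀ (insert v S₁)

elements : ∀ {n} → BitSet n → List (Vec Parity n)
elements ∅            = []
elements ⟨[]⟩         = [] ∷ []
elements (node S₀ S₁) = mapᴸ (0ℙ ∷_) (elements S₀) ++ mapᴸ (1ℙ ∷_) (elements S₁)

∈ᵇ⇒∈-elements : ∀ {n} (v : Vec Parity n) (S : BitSet n) → (v ∈ᵇ S) ≡ true → v ∈ elements S
∈ᵇ⇒∈-elements []       ⟨[]⟩         _   = here refl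
∈ᵇ⇒∈-elements (0ℙ ∷ v) (node S₀ S₁) v∈S = ∈-++⁺ˡ (∈-map⁺ (0ℙ ∷_) (∈ᵇ⇒∈-elements v S₀ v∈S))
∈ᵇ⇒∈-elements (1ℙ ∷ v) (node S₀ S₁) v∈S =
  ∈-++⁺ʳ (mapᴸ (0ℙ ∷_) (elements S₀)) (∈-map⁺ (1ℙ ∷_) (∈ᵇ⇒∈-elements v S₁ v∈S))

unconcat : Vec Parity 16 → Mat₂
unconcat (a ∷ b ∷ c ∷ d ∷ e ∷ f ∷ g ∷ h ∷ i ∷ j ∷ k ∷ l ∷ m ∷ n ∷ o ∷ p ∷ []) =
  (a ∷ b ∷ c ∷ d ∷ []) ∷ (e ∷ f ∷ g ∷ h ∷ []) ∷ (i ∷ j ∷ k ∷ l ∷ []) ∷ (m ∷ n ∷ o ∷ p ∷ []) ∷ []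

unconcat-concat : ∀ β → unconcat (concat β) ≡ β
unconcat-concat ((a ∷ b ∷ c ∷ d ∷ []) ∷ (e ∷ f ∷ g ∷ h ∷ []) ∷ (i ∷ j ∷ k ∷ l ∷ []) ∷ (m ∷ n ∷ o ∷ p ∷ []) ∷ []) =
  refl

infix 4 _∈ᴹ_
_∈ᴹ_ : Mat₂ → BitSet 16 → Set
β ∈ᴹ S = (concat β ∈ᵇ S) ≡ true

-- Depth-first search with fuel; nothing about it is proved, as closure of its result is checked by closedUnder.
orbit : ℕ → List Mat₂ → List Mat₂ → BitSet 16 → BitSet 16
orbit zero       gens todo       seen = seen
orbit (suc fuel) gens []         seen = seen
orbit (suc fuel) gens (β ∷ todo) seen = visit gens todo seen
  where
  visit : List Mat₂ → List Mat₂ → BitSet 16 → BitSet 16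
  visit []         todo seen = orbit fuel gens todo seen
  visit (g ∷ gens) todo seen =
    if concat (g ⊙ β) ∈ᵇ seen then visit gens todo seen
    else visit gens (g ⊙ β ∷ todo) (insert (concat (g ⊙ β)) seen)

closedUnder : Mat₂ → BitSet 16 → Bool
closedUnder g S = all (λ v → concat (g ⊙ unconcat v) ∈ᵇ S) (elements S)

closedUnder-sound : ∀ g S → closedUnder g S ≡ true → ∀ β → β ∈ᴹ S → g ⊙ β ∈ᴹ S
closedUnder-sound g S closed β β∈S =
  ≡.subst (λ γ → g ⊙ γ ∈ᴹ S) (unconcat-concat β)
    (Equivalence.to T-≡ (All.lookup (all⁺ _ (elements S) (Equivalence.from T-≡ closed))
                                    (∈ᵇ⇒∈-elements (concat β) S β∈S)))

Stabilises : BitSet 16 → Pred Mat 0ℓ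
Stabilises S M = ∀ B → reduce B ∈ᴹ S → reduce (M ⊗ B) ∈ᴹ S

Stabilises-I : ∀ S → Stabilises S I₄
Stabilises-I S B B∈S = ≡.subst (λ C → reduce C ∈ᴹ S) (≡.sym (⊗-identityˡ B)) B∈S

Stabilises-⊗ : ∀ S M N → Stabilises S M → Stabilises S N → Stabilises S (M ⊗ N)
Stabilises-⊗ S M N sM sN B B∈S = ≡.subst (λ C → reduce C ∈ᴹ S) (≡.sym (⊗-assoc M N B)) (sM (N ⊗ B) (sN B B∈S))

closedUnder⇒Stabilises : ∀ S M → closedUnder (reduce M) S ≡ true → Stabilises S M
closedUnder⇒Stabilises S M closed B B∈S =
  ≡.subst (_∈ᴹ S) (≡.sym (reduce-⊗ M B)) (closedUnder-sound (reduce M) S closed (reduce B) B∈S)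

X Y : Mat
X = K ⊗ L⁻¹
Y = K ⊗ L

G⁺ : Pred Mat 0ℓ
G⁺ = Gen (λ M → M ≡ X ⊎ M ≡ Y)

X∈G⁺ : G⁺ X
X∈G⁺ = gen (inj₁ refl)

Y∈G⁺ : G⁺ Y
Y∈G⁺ = gen (inj₂ refl)

X⁻¹∈G⁺ : G⁺ (L ⊗ K)
X⁻¹∈G⁺ = inv X∈G⁺ refl

Y⁻¹∈G⁺ : G⁺ (L⁻¹ ⊗ K)
Y⁻¹∈G⁺ = inv Y∈G⁺ refl

-- The words below are certificates: the equations they rely on are checked by evaluating the products.
T₁∈G⁺ : G⁺ T₁
T₁∈G⁺ = Gen-∏ (X∈G⁺ ∷ Y⁻¹∈G⁺ ∷ Y⁻¹∈G⁺ ∷ X∈G⁺ ∷ X∈G⁺ ∷ Y⁻¹∈G⁺ ∷ X∈G⁺ ∷ [])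

T∞∈G⁺ : G⁺ T∞
T∞∈G⁺ = Gen-^ 4 (Gen-∏ (X∈G⁺ ∷ Y⁻¹∈G⁺ ∷ X∈G⁺ ∷ Y⁻¹∈G⁺ ∷ X∈G⁺ ∷ []))

T₀∈G⁺ : G⁺ T₀
T₀∈G⁺ = inv (mul T₁∈G⁺ T∞∈G⁺) refl

Γ⊆G⁺ : Γ ⊆ G⁺
Γ⊆G⁺ = Gen-mono λ where
  (inj₁ refl)        → T₀∈G⁺
  (inj₂ (inj₁ refl)) → T₁∈G⁺
  (inj₂ (inj₂ refl)) → T∞∈G⁺

G⁺⊆Γ : G⁺ ⊆ Γ
G⁺⊆Γ = Gen-mono generators∈Γ
  where
  t₀ : Γ T₀
  t₀ = gen (inj₁ refl)
  t₁ : Γ T₁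
  t₁ = gen (inj₂ (inj₁ refl))
  t∞ : Γ T∞
  t∞ = gen (inj₂ (inj₂ refl))
  t₀⁻¹ : Γ (T₁ ⊗ T∞)
  t₀⁻¹ = mul t₁ t∞
  t₁⁻¹ : Γ (T∞ ⊗ T₀)
  t₁⁻¹ = mul t∞ t₀
  t∞⁻¹ : Γ (T₀ ⊗ T₁)
  t∞⁻¹ = mul t₀ t₁
  Y∈Γ : Γ Y
  Y∈Γ = Gen-∏ (t∞ ∷ t₀⁻¹ ∷ t₁ ∷ t∞⁻¹ ∷ t∞⁻¹ ∷ t₀⁻¹ ∷ t₀⁻¹ ∷ t₁ ∷ t∞⁻¹ ∷ t₀ ∷ t₀ ∷ t∞⁻¹ ∷ t∞⁻¹ ∷ [])
  y⁻¹ : Γ (L⁻¹ ⊗ K)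
  y⁻¹ = inv Y∈Γ refl
  X∈Γ : Γ X
  X∈Γ = Gen-∏ (t₁ ∷ t₁ ∷ y⁻¹ ∷ t∞ ∷ t₁ ∷ y⁻¹ ∷ t∞ ∷ t₁⁻¹ ∷ y⁻¹ ∷ t₁⁻¹ ∷ [])
  generators∈Γ : (λ M → M ≡ X ⊎ M ≡ Y) ⊆ Γ
  generators∈Γ (inj₁ refl) = X∈Γ
  generators∈Γ (inj₂ refl) = Y∈Γ

G⁺⊆[G,G] : G⁺ ⊆ Commutator G
G⁺⊆[G,G] = Gen-mono generators∈[G,G]
  where
  k : G K
  k = gen (inj₁ refl)
  l : G L
  l = gen (inj₂ refl)
  l⁻¹ : G L⁻¹
  l⁻¹ = inv l refl
  X∈[G,G] : Commutator G X
  X∈[G,G] = mul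
    (∏-commutator (L ∷ L ∷ L ∷ K ∷ []) (L⁻¹ ∷ L⁻¹ ∷ K ∷ L ∷ L ∷ L ∷ [])
                  (k ∷ l⁻¹ ∷ l⁻¹ ∷ l⁻¹ ∷ []) (l⁻¹ ∷ l⁻¹ ∷ l⁻¹ ∷ k ∷ l ∷ l ∷ []) refl refl)
    (∏-commutator (L⁻¹ ∷ K ∷ L⁻¹ ∷ K ∷ L⁻¹ ∷ L⁻¹ ∷ []) (K ∷ L⁻¹ ∷ L⁻¹ ∷ K ∷ L⁻¹ ∷ [])
                  (l ∷ l ∷ k ∷ l ∷ k ∷ l ∷ []) (l ∷ k ∷ l ∷ l ∷ k ∷ []) refl refl)
  Y∈[G,G] : Commutator G Y
  Y∈[G,G] = mul
    (∏-commutator (K ∷ L ∷ L ∷ K ∷ []) (L ∷ L ∷ L ∷ L ∷ L ∷ [])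
                  (k ∷ l⁻¹ ∷ l⁻¹ ∷ k ∷ []) (l⁻¹ ∷ l⁻¹ ∷ l⁻¹ ∷ l⁻¹ ∷ l⁻¹ ∷ []) refl refl)
    (∏-commutator (L⁻¹ ∷ L⁻¹ ∷ L⁻¹ ∷ K ∷ L⁻¹ ∷ []) (L ∷ L ∷ K ∷ L⁻¹ ∷ L⁻¹ ∷ [])
                  (l ∷ k ∷ l ∷ l ∷ l ∷ []) (l ∷ l ∷ k ∷ l⁻¹ ∷ l⁻¹ ∷ []) refl refl)
  generators∈[G,G] : (λ M → M ≡ X ⊎ M ≡ Y) ⊆ Commutator G
  generators∈[G,G] (inj₁ refl) = X∈[G,G]
  generators∈[G,G] (inj₂ refl) = Y∈[G,G]

-- K X K = Y⁻¹ and K Y K = X⁻¹.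
K-conjugates : (λ M → M ≡ X ⊎ M ≡ Y) ⊆ λ M → G⁺ (K ⊗ M ⊗ K)
K-conjugates (inj₁ refl) = Y⁻¹∈G⁺
K-conjugates (inj₂ refl) = X⁻¹∈G⁺

open InvolutionCosets K refl K-conjugates using (InSomeCoset; Gen⊆InSomeCoset; Commutator⊆)

K,L∈cosets : (λ M → M ≡ K ⊎ M ≡ L) ⊆ InSomeCoset
K,L∈cosets (inj₁ refl) = 1ℙ , one
K,L∈cosets (inj₂ refl) = 1ℙ , Y∈G⁺

[G,G]⊆G⁺ : Commutator G ⊆ G⁺
[G,G]⊆G⁺ = Commutator⊆ K,L∈cosets

-- Opaque, so that the orbit is only evaluated where membership in it is decided.
opaque
  G⁺-mod2 : BitSet 16
  G⁺-mod2 = orbit 360 (reduce X ∷ reduce Y ∷ []) (reduce I₄ ∷ []) (insert (concat (reduce I₄)) ∅)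

opaque
  unfolding G⁺-mod2

  I∈G⁺-mod2 : reduce I₄ ∈ᴹ G⁺-mod2
  I∈G⁺-mod2 = refl

  K∉G⁺-mod2 : ¬ reduce K ∈ᴹ G⁺-mod2
  K∉G⁺-mod2 ()

  G⁺-mod2-closed : (λ M → M ≡ X ⊎ M ≡ Y) ⊆ Invertible-in λ M → closedUnder (reduce M) G⁺-mod2 ≡ true
  G⁺-mod2-closed (inj₁ refl) = refl , L ⊗ K , refl , refl , refl
  G⁺-mod2-closed (inj₂ refl) = refl , L⁻¹ ⊗ K , refl , refl , refl

G⁺⊆Stabilises : G⁺ ⊆ Stabilises G⁺-mod2
G⁺⊆Stabilises =
  Gen-induction (Stabilises G⁺-mod2) (Stabilises-I G⁺-mod2) (λ {M} {N} → Stabilises-⊗ G⁺-mod2 M N) λ {M} s →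
    let (cM , M′ , MM′ , M′M , cM′) = G⁺-mod2-closed s in
    closedUnder⇒Stabilises G⁺-mod2 M cM , M′ , MM′ , M′M , closedUnder⇒Stabilises G⁺-mod2 M′ cM′

K∉G⁺ : ¬ G⁺ K
K∉G⁺ K∈G⁺ = K∉G⁺-mod2 (G⁺⊆Stabilises K∈G⁺ I₄ I∈G⁺-mod2)

[G,G]-cosets : InSomeCoset ⊆ λ g → Commutator G g ⊎ Σ Mat λ y → Commutator G y × g ≡ K ⊗ y
[G,G]-cosets     (0ℙ , g∈G⁺)  = inj₁ (G⁺⊆[G,G] g∈G⁺)
[G,G]-cosets {g} (1ℙ , Kg∈G⁺) = inj₂ (K ⊗ g , G⁺⊆[G,G] Kg∈G⁺ , ≡.sym (cancelˡ {a = K} {c = K} refl g))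

[G,G]-hasIndex2 : HasIndex2 (Commutator G) G
[G,G]-hasIndex2 =
  (λ _ → Commutator⊆Gen) , K , gen (inj₁ refl) , (λ K∈[G,G] → K∉G⁺ ([G,G]⊆G⁺ K∈[G,G])) ,
  (λ _ g∈G → [G,G]-cosets (Gen⊆InSomeCoset K,L∈cosets g∈G))

mainTheorem8 : T₀ ⊗ T₁ ⊗ T∞ ≡ I₄
    × (L ⊗ L⁻¹ ≡ I₄ × L⁻¹ ⊗ L ≡ I₄)
    × T₁ ≡ ((K ⊗ (L⁻¹ ^ᴹ 2)) ^ᴹ 3) ⊗ L⁻¹
    × T∞ ≡ (K ⊗ (L⁻¹ ^ᴹ 5)) ^ᴹ 4
    × (∀ M → (Γ M → Commutator G M) × (Commutator G M → Γ M))
    × HasIndex2 (Commutator G) G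
mainTheorem8 =
  refl , (refl , refl) , refl , refl ,
  (λ M → (λ M∈Γ → G⁺⊆[G,G] (Γ⊆G⁺ M∈Γ)) , (λ M∈[G,G] → G⁺⊆Γ ([G,G]⊆G⁺ M∈[G,G]))) ,
  [G,G]-hasIndex2
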